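{- Let $\mathbb{T}$ be a $\mathcal{V}_{\mathsf{Node}}$-structure and $\mathcal{H}$ a $\mathbb{T}$-proof space. Then $\mathcal{L}(\mathcal{H})$ is closed under $\simeq$ on words: if $\rho\in\mathcal{L}(\mathcal{H})$ and $\rho'\in(\Sigma\times\mathbb{T})^*$ with $\rho'\simeq\rho$, then $\rho'\in\mathcal{L}(\mathcal{H})$.
   Context: For a structure and a set $V$ of elements, $N(V)$ is the substructure generated by $V$; $N(\vec a)$ is that of the set of entries of a tuple $\vec a$; juxtaposition of tuples denotes concatenation. For tuples $\vec a,\vec b$ of equal length in $\mathbb{T}$, a local isomorphism from $\vec a$ to $\vec b$ is an isomorphism $\beta:N(\vec a)\to N(\vec b)$ with $\beta(\vec a)=\vec b$; $\vec a\simeq\vec b$ if one exists. $\Sigma$ is a finite set of commands and $\mathcal{V}_{\mathsf{Data}}$ a vocabulary for data. On words, $\langle\sigma_1:v_1\rangle\cdots\langle\sigma_n:v_n\rangle\simeq\langle\sigma'_1:v'_1\rangle\cdots\langle\sigma'_{n'}:v'_{n'}\rangle$ iff $(\sigma_1,\dots,\sigma_n)=(\sigma'_1,\dots,\sigma'_{n'})$ and $(v_1,\dots,v_n)\simeq(v'_1,\dots,v'_n)$. Hoare triples over $\Sigma\times\mathbb{T}$ have the form $\{A\}\,\rho\,\{B\}$ with $\rho\in(\Sigma\times\mathbb{T})^*$ and assertions $A,B$ of the form $\phi[\mu(u_1),\dots,\mu(u_m)]$ ($\phi$ a $\mathcal{V}_{\mathsf{Data}}$-formula, $u_j\in\mathbb{T}$,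 $\mu$ a formal unary symbol); assertions are viewed as conjunctions of their conjuncts. Rules: Sequencing — from $\{A_1\}\rho_1\{A_2\}$ and $\{A_2'\}\rho_2\{A_3\}$, where every conjunct of $A_2'$ is a conjunct of $A_2$, derive $\{A_1\}\rho_1\rho_2\{A_3\}$; Conjunction — from $\{A_1\}\rho\{B_1\}$ and $\{A_2\}\rho\{B_2\}$ derive $\{A_1\wedge A_2\}\rho\{B_1\wedge B_2\}$; S-param — from $\{\phi[\overrightarrow{\mu(u)}]\}\langle\sigma_1:v_1\rangle\cdots\langle\sigma_n:v_n\rangle\{\psi[\overrightarrow{\mu(w)}]\}$ derive $\{\phi[\overrightarrow{\mu(u')}]\}\langle\sigma_1:v'_1\rangle\cdots\langle\sigma_n:v'_n\rangle\{\psi[\overrightarrow{\mu(w')}]\}$ whenever $|\vec u|=|\vec u'|$, $|\vec w|=|\vec w'|$ and $\vec u\vec v\vec w\simeq\vec u'\vec v'\vec w'$ in $\mathbb{T}$. A $\mathbb{T}$-proof space is a set of Hoare triples closed under these three rules. Its language is $\mathcal{L}(\mathcal{H})=\{\rho\in(\Sigma\times\mathbb{T})^*:\{\top\}\rho\{\bot\}\in\mathcal{H}\}$. -}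

module Defs where

open import Data.Nat using (ℕ)
open import Data.Fin using (Fin)
open import Data.Product using (Σ; Σ-syntax; _×_; _,_; proj₁; proj₂)
open import Data.List using (List; []; _∷_; map; _++_; concatMap)
open import Data.List.Membership.Propositional using (_∈_)
open import Data.List.Relation.Binary.Pointwise using (Pointwise)
open import Data.Vec as V using (Vec; []; _∷_; toList)
open import Data.Vec.Relation.Unary.All as VAll using ([]; _∷_) renaming (All to VAll)
open import Function using (_∘_; _⇔_)
open import Relation.Binary.PropositionalEquality using (_≡_)

record Vocabulary : Set₁ where
  field
    FunSym : Set
    funAr  : FunSym → ℕ
    RelSym : Set
    relAr  : RelSym → ℕ

record Structure (𝒱 : Vocabulary) : Set₁ where
  open Vocabulary 𝒱
  field
    Carrier : Set
    fun     : (f : FunSym) → Vec Carrier (funAr f) → Carrier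
    rel     : (r : RelSym) → Vec Carrier (relAr r) → Set

module LocalIsos {𝒱 : Vocabulary} (𝕋 : Structure 𝒱) where
  open Vocabulary 𝒱
  open Structure 𝕋

  data Gen (a : List Carrier) : Carrier → Set where
    base : ∀ {x} → x ∈ a → Gen a x
    app  : (f : FunSym) (xs : Vec Carrier (funAr f)) → VAll (Gen a) xs → Gen a (fun f xs)

  -- the domain of N(a); elements are compared by their first component
  N : List Carrier → Set
  N a = Σ Carrier (Gen a)

  liftAll : ∀ {a n} (xs : Vec (N a) n) → VAll (Gen a) (V.map proj₁ xs)
  liftAll []       = []
  liftAll (x ∷ xs) = proj₂ x ∷ liftAll xs

  record LocalIso (a b : List Carrier) : Set where
    field
      to      : N a → N b
      from    : N b → N a
      to-cong   : ∀ {x y} → proj₁ x ≡ proj₁ y → proj₁ (to x) ≡ proj₁ (to y)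
      from-cong : ∀ {x y} → proj₁ x ≡ proj₁ y → proj₁ (from x) ≡ proj₁ (from y)
      from-to : ∀ x → proj₁ (from (to x)) ≡ proj₁ x
      to-from : ∀ y → proj₁ (to (from y)) ≡ proj₁ y
      to-fun  : ∀ f (xs : Vec (N a) (funAr f)) →
                proj₁ (to (fun f (V.map proj₁ xs) , app f (V.map proj₁ xs) (liftAll xs)))
                  ≡ fun f (V.map (proj₁ ∘ to) xs)
      to-rel  : ∀ r (xs : Vec (N a) (relAr r)) →
                rel r (V.map proj₁ xs) ⇔ rel r (V.map (proj₁ ∘ to) xs)
      to-tuple : Pointwise (λ x y → (p : Gen a x) → proj₁ (to (x , p)) ≡ y) a b

  _≃_ : List Carrier → List Carrier → Set
  a ≃ b = LocalIso a b

-- Hoare triples over Σ × 𝕋 and proof spaces.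
-- Σ = Fin k (a finite set of commands); 𝒱_Data-formulas with m free
-- slots are abstracted as a family Fml m, with a distinguished ff : Fml 0
-- (the formula ⊥).

module Hoare {𝒱 : Vocabulary} (𝕋 : Structure 𝒱) (k : ℕ)
             (Fml : ℕ → Set) (ff : Fml 0) where
  open Structure 𝕋
  open LocalIsos 𝕋 public

  Cmd : Set
  Cmd = Fin k

  Word : Set
  Word = List (Cmd × Carrier)

  cmds : Word → List Cmd
  cmds = map proj₁

  vals : Word → List Carrier
  vals = map proj₂

  _≃w_ : Word → Word → Set
  ρ ≃w ρ' = (cmds ρ ≡ cmds ρ') × (vals ρ ≃ vals ρ')

  Conjunct : Set
  Conjunct = Σ[ m ∈ ℕ ] (Fml m × Vec Carrier m)

  -- an assertion is the conjunction of its list of conjuncts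
  Assertion : Set
  Assertion = List Conjunct

  ⊤ₐ : Assertion
  ⊤ₐ = []

  ⊥ₐ : Assertion
  ⊥ₐ = (0 , ff , []) ∷ []

  _∧ₐ_ : Assertion → Assertion → Assertion
  A ∧ₐ B = A ++ B

  shape : Assertion → List (Σ ℕ Fml)
  shape = map (λ c → proj₁ c , proj₁ (proj₂ c))

  params : Assertion → List Carrier
  params = concatMap (λ c → toList (proj₂ (proj₂ c)))

  record Triple : Set where
    constructor ⟪_⟫_⟪_⟫
    field
      pre  : Assertion
      word : Word
      post : Assertion

  record IsProofSpace (H : Triple → Set) : Set where
    field
      sequencing : ∀ A₁ ρ₁ A₂ A₂' ρ₂ A₃ →
        H ⟪ A₁ ⟫ ρ₁ ⟪ A₂ ⟫ → H ⟪ A₂' ⟫ ρ₂ ⟪ A₃ ⟫ →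
        (∀ {c} → c ∈ A₂' → c ∈ A₂) →
        H ⟪ A₁ ⟫ (ρ₁ ++ ρ₂) ⟪ A₃ ⟫
      conjunction : ∀ A₁ A₂ ρ B₁ B₂ →
        H ⟪ A₁ ⟫ ρ ⟪ B₁ ⟫ → H ⟪ A₂ ⟫ ρ ⟪ B₂ ⟫ →
        H ⟪ A₁ ∧ₐ A₂ ⟫ ρ ⟪ B₁ ∧ₐ B₂ ⟫
      s-param : ∀ A ρ B A' ρ' B' →
        shape A ≡ shape A' → cmds ρ ≡ cmds ρ' → shape B ≡ shape B' →
        (params A ++ vals ρ ++ params B) ≃ (params A' ++ vals ρ' ++ params B') →
        H ⟪ A ⟫ ρ ⟪ B ⟫ → H ⟪ A' ⟫ ρ' ⟪ B' ⟫

  ℒ : (Triple → Set) → Word → Set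
  ℒ H ρ = H ⟪ ⊤ₐ ⟫ ρ ⟪ ⊥ₐ ⟫

{-# OPTIONS --safe #-}
-- ⊤ and ⊥ carry no parameters, so for the triple {⊤} ρ {⊥} the side condition
-- of S-param is just a local isomorphism from vals ρ to vals ρ'; the only work
-- is that the inverse of a local isomorphism is again one.
module Submission where

open import Defs
open import Data.Nat using (ℕ)
open import Data.Product using (_,_; proj₁)
open import Data.List using (_∷_)
open import Data.List.Properties using (++-identityʳ)
open import Data.List.Membership.Propositional using (_∈_)
open import Data.List.Relation.Unary.Any using (here; there)
open import Data.List.Relation.Binary.Pointwise using (Pointwise; []; _∷_)
import Data.Vec as V
open import Data.Vec using (Vec)
open import Data.Vec.Properties using (map-∘; map-cong)
open import Function using (_∘_; _⇔_)
import Function.Properties.Equivalence as ⇔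
open import Relation.Binary.PropositionalEquality

module _ {𝒱 : Vocabulary} (𝕋 : Structure 𝒱) where
  open Vocabulary 𝒱
  open Structure 𝕋
  open LocalIsos 𝕋

  ≃-sym : ∀ {a b} → a ≃ b → b ≃ a
  ≃-sym {a} {b} L = record
    { to        = from
    ; from      = to
    ; to-cong   = from-cong
    ; from-cong = to-cong
    ; from-to   = to-from
    ; to-from   = from-to
    ; to-fun    = from-fun
    ; to-rel    = from-rel
    ; to-tuple  = from-tuple base to-tuple
    }
    where
    open LocalIso L

    from-of-to : ∀ x {y} → proj₁ y ≡ proj₁ (to x) → proj₁ (from y) ≡ proj₁ x
    from-of-to x y≡to-x = trans (from-cong y≡to-x) (from-to x)

    map-proj₁-from : ∀ {n} (ys : Vec (N b) n) →
                     V.map proj₁ (V.map from ys) ≡ V.map (proj₁ ∘ from) ys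
    map-proj₁-from ys = sym (map-∘ proj₁ from ys)

    map-to-from : ∀ {n} (ys : Vec (N b) n) →
                  V.map (proj₁ ∘ to) (V.map from ys) ≡ V.map proj₁ ys
    map-to-from ys = trans (sym (map-∘ (proj₁ ∘ to) from ys)) (map-cong to-from ys)

    from-fun : ∀ f (ys : Vec (N b) (funAr f)) →
               proj₁ (from (fun f (V.map proj₁ ys) , app f (V.map proj₁ ys) (liftAll ys)))
                 ≡ fun f (V.map (proj₁ ∘ from) ys)
    from-fun f ys = begin
      proj₁ (from (fun f (V.map proj₁ ys) , _)) ≡⟨ from-of-to (_ , app f (V.map proj₁ xs) (liftAll xs)) fun-ys≡to ⟩
      fun f (V.map proj₁ xs)                    ≡⟨ cong (fun f) (map-proj₁-from ys) ⟩
      fun f (V.map (proj₁ ∘ from) ys)           ∎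
      where
      open ≡-Reasoning
      xs = V.map from ys
      fun-ys≡to : fun f (V.map proj₁ ys)
                    ≡ proj₁ (to (fun f (V.map proj₁ xs) , app f (V.map proj₁ xs) (liftAll xs)))
      fun-ys≡to = sym (trans (to-fun f xs) (cong (fun f) (map-to-from ys)))

    from-rel : ∀ r (ys : Vec (N b) (relAr r)) →
               rel r (V.map proj₁ ys) ⇔ rel r (V.map (proj₁ ∘ from) ys)
    from-rel r ys = ⇔.sym (subst₂ _⇔_ (cong (rel r) (map-proj₁-from ys))
                                      (cong (rel r) (map-to-from ys))
                                      (to-rel r (V.map from ys)))

    from-tuple : ∀ {as bs} → (∀ {x} → x ∈ as → Gen a x) →
                 Pointwise (λ x y → (p : Gen a x) → proj₁ (to (x , p)) ≡ y) as bs →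
                 Pointwise (λ y x → (q : Gen b y) → proj₁ (from (y , q)) ≡ x) bs as
    from-tuple gen [] = []
    from-tuple {x ∷ _} gen (to-x≡y ∷ rest) =
      (λ _ → from-of-to (x , gen (here refl)) (sym (to-x≡y (gen (here refl)))))
      ∷ from-tuple (gen ∘ there) rest

module _ {𝒱 : Vocabulary} {𝕋 : Structure 𝒱} {k : ℕ} {Fml : ℕ → Set} {ff : Fml 0} where
  open Hoare 𝕋 k Fml ff

  ≃w-sym : ∀ {ρ ρ'} → ρ ≃w ρ' → ρ' ≃w ρ
  ≃w-sym (same-cmds , vals≃) = sym same-cmds , ≃-sym 𝕋 vals≃

  ℒ-respects-≃w : ∀ {H} → IsProofSpace H → ∀ {ρ ρ'} → ρ ≃w ρ' → ℒ H ρ → ℒ H ρ'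
  ℒ-respects-≃w PS {ρ} {ρ'} (same-cmds , vals≃) =
    IsProofSpace.s-param PS ⊤ₐ ρ ⊥ₐ ⊤ₐ ρ' ⊥ₐ refl same-cmds refl
      (subst₂ _≃_ (sym (++-identityʳ (vals ρ))) (sym (++-identityʳ (vals ρ'))) vals≃)

theorem5p6 : (𝒱Node : Vocabulary) (𝕋 : Structure 𝒱Node) (k : ℕ)
             (Fml : ℕ → Set) (ff : Fml 0) (H : Hoare.Triple 𝕋 k Fml ff → Set) →
             Hoare.IsProofSpace 𝕋 k Fml ff H →
             (ρ ρ' : Hoare.Word 𝕋 k Fml ff) →
             Hoare.ℒ 𝕋 k Fml ff H ρ →
             Hoare._≃w_ 𝕋 k Fml ff ρ' ρ →
             Hoare.ℒ 𝕋 k Fml ff H ρ'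
theorem5p6 𝒱Node 𝕋 k Fml ff H PS ρ ρ' ρ∈ℒ ρ'≃ρ = ℒ-respects-≃w PS (≃w-sym {Fml = Fml} {ff = ff} ρ'≃ρ) ρ∈ℒ
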